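{- Let $n\ge1$. If every set of infinite partitions of $\omega$ defined by a $\Sigma^1_n$ formula (with real parameters) has the dual-Ramsey property, then every $\Sigma^1_n$ subset of $[\omega]^\omega$ has the Ramsey property.
   Context: $[\omega]^\omega$ is the set of infinite subsets of $\omega$; for $x\in[\omega]^\omega$, $[x]^\omega$ is the set of infinite subsets of $x$. $C\subseteq[\omega]^\omega$ has the Ramsey property if there is $x\in[\omega]^\omega$ with $[x]^\omega\subseteq C$ or $[x]^\omega\cap C=\emptyset$. A partition of $\omega$ is a set of nonempty pairwise disjoint subsets (blocks) of $\omega$ whose union is $\omega$; $(\omega)^\omega$ is the set of partitions with infinitely many blocks, identified with reals via the code $\mathrm{pac}(P)=\{\flat\{n,m\}: n\neq m \text{ in different blocks of } P\}$, where $\flat\{n,m\}=\frac12(\max\{n,m\}^2-\max\{n,m\})+\min\{n,m\}$. For partitions $X,Y$, $Y\sqsubseteq X$ means every block of $Y$ is a union of blocks of $X$; $(X)^\omega=\{Y\in(\omega)^\omega:Y\sqsubseteq X\}$. $A\subseteq(\omega)^\omega$ has the dual-Ramsey property if some $X\in(\omega)^\omega$ satisfies $(X)^\omega\subseteq A$ or $(X)^\omega\cap A=\emptyset$. -}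

module Defs where

open import Data.Nat using (ℕ; zero; suc; _+_; _*_; _∸_; _≤_; _<_; _⊔_; _⊓_)
open import Data.Nat.DivMod using (_/_)
open import Data.Bool using (Bool; true; false)
open import Data.Fin using (Fin)
import Data.Fin as F
open import Data.Product using (Σ; _×_; _,_)
open import Data.Sum using (_⊎_)
open import Data.Empty using (⊥)
open import Relation.Nullary using (¬_)
open import Relation.Binary.PropositionalEquality using (_≡_)
open import Function.Bundles using (_⇔_)

Real : Set
Real = ℕ → Bool

Infinite : Real → Set
Infinite x = (k : ℕ) → Σ ℕ λ m → k ≤ m × x m ≡ true

_⊆ᵣ_ : Real → Real → Set
y ⊆ᵣ x = (n : ℕ) → y n ≡ true → x n ≡ true

RamseyProperty : (Real → Set) → Set
RamseyProperty C =
  Σ Real λ x → Infinite x ×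
    ( ((y : Real) → Infinite y → y ⊆ᵣ x → C y)
    ⊎ ((y : Real) → Infinite y → y ⊆ᵣ x → ¬ C y))

-- Partitions of ω, coded by reals via pac.
-- ♭{n,m} = (max² − max)/2 + min
flat : ℕ → ℕ → ℕ
flat n m = ((n ⊔ m) * (n ⊔ m) ∸ (n ⊔ m)) / 2 + (n ⊓ m)

-- n and m lie in the same block of the partition coded by c
-- (pac(P) contains ♭{n,m} exactly when n ≠ m lie in different blocks)
SameBlock : Real → ℕ → ℕ → Set
SameBlock c n m = n ≡ m ⊎ c (flat n m) ≡ false

-- c is the code pac(P) of a partition P of ω: "same block" is an
-- equivalence relation (reflexivity and symmetry are automatic).
IsPartitionCode : Real → Set
IsPartitionCode c = (n m k : ℕ) → SameBlock c n m → SameBlock c m k → SameBlock c n k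

InfManyBlocks : Real → Set
InfManyBlocks c = (N : ℕ) → Σ (Fin N → ℕ) λ e →
  (i j : Fin N) → ¬ (i ≡ j) → ¬ SameBlock c (e i) (e j)

InfPartition : Real → Set
InfPartition c = IsPartitionCode c × InfManyBlocks c

_⊑_ : Real → Real → Set
Y ⊑ X = (n m : ℕ) → SameBlock X n m → SameBlock Y n m

DualRamseyProperty : (Real → Set) → Set
DualRamseyProperty A =
  Σ Real λ X → InfPartition X ×
    ( ((Y : Real) → InfPartition Y → Y ⊑ X → A Y)
    ⊎ ((Y : Real) → InfPartition Y → Y ⊑ X → ¬ A Y))

-- Second-order arithmetic: terms and formulas with k number variables
-- and m real (set) variables, de Bruijn style.

data Term (k : ℕ) : Set where
  var  : Fin k → Term k
  zer  : Term k
  succ : Term k → Term k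
  plus : Term k → Term k → Term k
  times : Term k → Term k → Term k

data Formula (k m : ℕ) : Set where
  eq   : Term k → Term k → Formula k m
  lt   : Term k → Term k → Formula k m
  mem  : Term k → Fin m → Formula k m
  neg  : Formula k m → Formula k m
  conj : Formula k m → Formula k m → Formula k m
  disj : Formula k m → Formula k m → Formula k m
  impl : Formula k m → Formula k m → Formula k m
  allN : Formula (suc k) m → Formula k m
  exN  : Formula (suc k) m → Formula k m
  allR : Formula k (suc m) → Formula k m
  exR  : Formula k (suc m) → Formula k m

extend : ∀ {A : Set} {k} → A → (Fin k → A) → Fin (suc k) → A
extend a ρ F.zero    = a
extend a ρ (F.suc i) = ρ i

evalT : ∀ {k} → (Fin k → ℕ) → Term k → ℕ
evalT ρ (var i)     = ρ i
evalT ρ zer         = zero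
evalT ρ (succ t)    = suc (evalT ρ t)
evalT ρ (plus t s)  = evalT ρ t + evalT ρ s
evalT ρ (times t s) = evalT ρ t * evalT ρ s

Sat : ∀ {k m} → Formula k m → (Fin k → ℕ) → (Fin m → Real) → Set
Sat (eq t s)   ρ σ = evalT ρ t ≡ evalT ρ s
Sat (lt t s)   ρ σ = evalT ρ t < evalT ρ s
Sat (mem t X)  ρ σ = σ X (evalT ρ t) ≡ true
Sat (neg φ)    ρ σ = ¬ Sat φ ρ σ
Sat (conj φ ψ) ρ σ = Sat φ ρ σ × Sat ψ ρ σ
Sat (disj φ ψ) ρ σ = Sat φ ρ σ ⊎ Sat ψ ρ σ
Sat (impl φ ψ) ρ σ = Sat φ ρ σ → Sat ψ ρ σ
Sat (allN φ)   ρ σ = (a : ℕ) → Sat φ (extend a ρ) σ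
Sat (exN φ)    ρ σ = Σ ℕ λ a → Sat φ (extend a ρ) σ
Sat (allR φ)   ρ σ = (X : Real) → Sat φ ρ (extend X σ)
Sat (exR φ)    ρ σ = Σ Real λ X → Sat φ ρ (extend X σ)

data Arith {k m : ℕ} : Formula k m → Set where
  eq   : ∀ t s → Arith (eq t s)
  lt   : ∀ t s → Arith (lt t s)
  mem  : ∀ t X → Arith (mem t X)
  neg  : ∀ {φ} → Arith φ → Arith (neg φ)
  conj : ∀ {φ ψ} → Arith φ → Arith ψ → Arith (conj φ ψ)
  disj : ∀ {φ ψ} → Arith φ → Arith ψ → Arith (disj φ ψ)
  impl : ∀ {φ ψ} → Arith φ → Arith ψ → Arith (impl φ ψ)
  allN : ∀ {φ} → Arith φ → Arith (allN φ)
  exN  : ∀ {φ} → Arith φ → Arith (exN φ)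

-- Σ¹ₙ / Π¹ₙ formulas in the usual normal form
-- ∃X₁ ∀X₂ … Q Xₙ θ  (θ arithmetical), resp. ∀X₁ ∃X₂ … θ.
mutual
  data IsΣ¹ {k : ℕ} : (n : ℕ) → {m : ℕ} → Formula k m → Set where
    arith : ∀ {m} {φ : Formula k m} → Arith φ → IsΣ¹ 0 φ
    ex    : ∀ {n m} {φ : Formula k (suc m)} → IsΠ¹ n φ → IsΣ¹ (suc n) (exR φ)

  data IsΠ¹ {k : ℕ} : (n : ℕ) → {m : ℕ} → Formula k m → Set where
    arith : ∀ {m} {φ : Formula k m} → Arith φ → IsΠ¹ 0 φ
    all   : ∀ {n m} {φ : Formula k (suc m)} → IsΣ¹ n φ → IsΠ¹ (suc n) (allR φ)

noNum : Fin 0 → ℕ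
noNum ()

-- The set of reals defined by φ(x, p₁,…,p_m): variable 0 is x,
-- variables 1..m are the real parameters.
DefSet : ∀ {m} → Formula 0 (suc m) → (Fin m → Real) → Real → Set
DefSet φ p x = Sat φ noNum (extend x p)

-- Given an infinite partition X, let x be the set of nonzero minima of its blocks. An infinite
-- y ⊆ x is coded by the coarsening Y of X that sends each X-block to the block of the last
-- element of y ∪ {0} not above its minimum: then y is exactly the set of nonzero block minima of
-- Y, which is arithmetical in Y. Replacing membership in the argument of a Σ¹ₙ formula φ by this
-- arithmetical condition gives a Σ¹ₙ formula φ' with φ'(Y) ⇔ φ(y), so a partition X homogeneous
-- for φ' makes x homogeneous for φ.

module Submission where

open import Axiom.ExcludedMiddle using (ExcludedMiddle)
open import Data.Bool as Bool using (Bool; true; false; not; if_then_else_)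
open import Data.Bool.Properties using (not-¬; ¬-not)
open import Data.Empty using (⊥-elim)
open import Data.Fin using (Fin; toℕ; fromℕ<) renaming (zero to fzero; suc to fsuc)
import Data.Fin.Properties as Finₚ
open import Data.Nat using (ℕ; zero; suc; _+_; _*_; _∸_; _≤_; _<_; z≤n; s≤s; s≤s⁻¹; z<s; _≟_; _<?_; _≤?_)
open import Data.Nat.DivMod using (_/_; m*n/n≡m)
open import Data.Nat.Properties
open import Data.Nat.Solver using (module +-*-Solver)
open import Data.Product using (Σ; _×_; _,_; proj₁; proj₂)
open import Data.Product.Function.NonDependent.Propositional using (_×-⇔_)
open import Data.Sum as Sum using (_⊎_; inj₁; inj₂)
open import Data.Sum.Function.Propositional using (_⊎-⇔_)
open import Function using (_∘_)
open import Function.Bundles using (_⇔_; mk⇔; Equivalence)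
import Function.Properties.Equivalence as ⇔
open import Function.Related.TypeIsomorphisms using (→-cong-⇔; ¬-cong-⇔)
open import Level using (0ℓ)
open import Relation.Binary using (tri<; tri≈; tri>)
open import Relation.Binary.PropositionalEquality
open import Relation.Nullary using (¬_; Dec; yes; no; does)
open import Relation.Nullary.Decidable using (_⊎-dec_; _×-dec_; ¬?; dec-true)
open import Relation.Unary using (Decidable)

open import Defs

open +-*-Solver using (solve; _:=_; _:+_; _:*_; con)

triangle : ℕ → ℕ
triangle zero    = zero
triangle (suc m) = triangle m + m

triangle-twice : ∀ m → triangle m + triangle m + m ≡ m * m
triangle-twice zero    = refl
triangle-twice (suc m) = begin
  (t + m) + (t + m) + suc m  ≡⟨ regroup t m ⟩
  (t + t + m) + suc (m + m)  ≡⟨ cong (_+ suc (m + m)) (triangle-twice m) ⟩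
  m * m + suc (m + m)        ≡⟨ square-suc m ⟩
  suc m * suc m              ∎
  where
  open ≡-Reasoning
  t : ℕ
  t = triangle m
  regroup : ∀ a b → (a + b) + (a + b) + suc b ≡ (a + a + b) + suc (b + b)
  regroup = solve 2 (λ a b → (a :+ b) :+ (a :+ b) :+ (con 1 :+ b)
                           := (a :+ a :+ b) :+ (con 1 :+ (b :+ b))) refl
  square-suc : ∀ b → b * b + suc (b + b) ≡ suc b * suc b
  square-suc = solve 1 (λ b → b :* b :+ (con 1 :+ (b :+ b)) := (con 1 :+ b) :* (con 1 :+ b)) refl

triangle-mono-≤ : ∀ {m m'} → m ≤ m' → triangle m ≤ triangle m'
triangle-mono-≤ z≤n       = z≤n
triangle-mono-≤ (s≤s m≤m') = +-mono-≤ (triangle-mono-≤ m≤m') m≤m'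

-- Terms have no subtraction or division, so formulas name ♭{n,m} as q + n with q + q + m = m * m.
flat-≡ : ∀ {q n m} → q + q + m ≡ m * m → n < m → flat n m ≡ q + n
flat-≡ {q} {n} {m} twice n<m
  rewrite m≤n⇒m⊔n≡n (<⇒≤ n<m) | m≤n⇒m⊓n≡m (<⇒≤ n<m) = cong (_+ n) (begin
    (m * m ∸ m) / 2      ≡⟨ cong (λ z → (z ∸ m) / 2) (sym twice) ⟩
    (q + q + m ∸ m) / 2  ≡⟨ cong (_/ 2) (m+n∸n≡m (q + q) m) ⟩
    (q + q) / 2          ≡⟨ cong (_/ 2) (solve 1 (λ a → a :+ a := a :* con 2) refl q) ⟩
    q * 2 / 2            ≡⟨ m*n/n≡m q 2 ⟩
    q                    ∎)
  where open ≡-Reasoning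

flat-< : ∀ {n m} → n < m → flat n m ≡ triangle m + n
flat-< {m = m} = flat-≡ (triangle-twice m)

flat-comm : ∀ n m → flat n m ≡ flat m n
flat-comm n m rewrite ⊔-comm n m | ⊓-comm n m = refl

triangle-<-pair : ∀ {n m n' m'} → n < m → m < m' → triangle m + n < triangle m' + n'
triangle-<-pair {n} {m} {n'} {m'} n<m m<m' = begin-strict
  triangle m + n     <⟨ +-monoʳ-< (triangle m) n<m ⟩
  triangle (suc m)   ≤⟨ triangle-mono-≤ m<m' ⟩
  triangle m'        ≤⟨ m≤m+n (triangle m') n' ⟩
  triangle m' + n'   ∎
  where open ≤-Reasoning

triangle-pair-injective : ∀ {n m n' m'} → n < m → n' < m' →
  triangle m + n ≡ triangle m' + n' → n ≡ n' × m ≡ m'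
triangle-pair-injective {m = m} {m' = m'} n<m n'<m' e with <-cmp m m'
... | tri≈ _ refl _ = +-cancelˡ-≡ (triangle m) _ _ e , refl
... | tri< m<m' _ _ = ⊥-elim (<⇒≢ (triangle-<-pair n<m m<m') e)
... | tri> _ _ m'<m = ⊥-elim (<⇒≢ (triangle-<-pair n'<m' m'<m) (sym e))

EncodesPair : ℕ × ℕ → ℕ → Set
EncodesPair (n , m) k = n < m × triangle m + n ≡ k

nextPair : ℕ × ℕ → ℕ × ℕ
nextPair (n , m) with suc n <? m
... | yes _ = suc n , m
... | no  _ = zero , suc m

nextPair-encodes : ∀ {k} p → EncodesPair p k → EncodesPair (nextPair p) (suc k)
nextPair-encodes (n , m) (n<m , e) with suc n <? m
... | yes 1+n<m = 1+n<m , trans (+-suc (triangle m) n) (cong suc e)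
... | no  1+n≮m with m≤n⇒m<n∨m≡n n<m
...   | inj₁ 1+n<m  = ⊥-elim (1+n≮m 1+n<m)
...   | inj₂ refl = z<s , trans (+-identityʳ _) (trans (+-suc (triangle m) n) (cong suc e))

-- Inverse of ♭ on pairs n < m, listing them in the order (0,1), (0,2), (1,2), (0,3), …
unflat : ℕ → ℕ × ℕ
unflat zero    = zero , 1
unflat (suc k) = nextPair (unflat k)

unflat-encodes : ∀ k → EncodesPair (unflat k) k
unflat-encodes zero    = z<s , refl
unflat-encodes (suc k) = nextPair-encodes (unflat k) (unflat-encodes k)

unflat-flat : ∀ {n m} → n < m → unflat (flat n m) ≡ (n , m)
unflat-flat {n} {m} n<m with unflat (flat n m) | unflat-encodes (flat n m)
... | n' , m' | n'<m' , e with triangle-pair-injective n'<m' n<m (trans e (flat-< n<m))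
...   | refl , refl = refl

not-does≡false⇔ : ∀ {A : Set} (a? : Dec A) → not (does a?) ≡ false ⇔ A
not-does≡false⇔ (yes a) = mk⇔ (λ _ → a) (λ _ → refl)
not-does≡false⇔ (no ¬a) = mk⇔ (λ ()) (λ a → ⊥-elim (¬a a))

does≡true⇔ : ∀ {A : Set} (a? : Dec A) → does a? ≡ true ⇔ A
does≡true⇔ (yes a) = mk⇔ (λ _ → a) (λ _ → refl)
does≡true⇔ (no ¬a) = mk⇔ (λ ()) (λ a → ⊥-elim (¬a a))

SameBlock-sym : ∀ {c n m} → SameBlock c n m → SameBlock c m n
SameBlock-sym         (inj₁ n≡m) = inj₁ (sym n≡m)
SameBlock-sym {c} {n} {m} (inj₂ e) = inj₂ (subst (λ k → c k ≡ false) (flat-comm n m) e)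

SameBlock? : ∀ c n m → Dec (SameBlock c n m)
SameBlock? c n m = (n ≟ m) ⊎-dec (c (flat n m) Bool.≟ false)

differentBlocks⇔ : ∀ {c n m} → n ≢ m → c (flat n m) ≡ true ⇔ (¬ SameBlock c n m)
differentBlocks⇔ {c} {n} {m} n≢m = mk⇔ to from
  where
  to : c (flat n m) ≡ true → ¬ SameBlock c n m
  to _ (inj₁ n≡m) = n≢m n≡m
  to e (inj₂ f)   = not-¬ e f
  from : ¬ SameBlock c n m → c (flat n m) ≡ true
  from different = ¬-not (λ e → different (inj₂ e))

kernelCode : (ℕ → ℕ) → Real
kernelCode g k = let (n , m) = unflat k in not (does (g n ≟ g m))

kernelCode-flat : ∀ g {n m} → n < m → kernelCode g (flat n m) ≡ false ⇔ g n ≡ g m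
kernelCode-flat g {n} {m} n<m rewrite unflat-flat n<m = not-does≡false⇔ (g n ≟ g m)

sameBlock-kernel⇔ : ∀ g {n m} → SameBlock (kernelCode g) n m ⇔ g n ≡ g m
sameBlock-kernel⇔ g {n} {m} = mk⇔ to from
  where
  to : SameBlock (kernelCode g) n m → g n ≡ g m
  to (inj₁ n≡m) = cong g n≡m
  to (inj₂ e) with <-cmp n m
  ... | tri< n<m _ _ = Equivalence.to (kernelCode-flat g n<m) e
  ... | tri≈ _ n≡m _ = cong g n≡m
  ... | tri> _ _ m<n = sym (Equivalence.to (kernelCode-flat g m<n)
                             (subst (λ k → kernelCode g k ≡ false) (flat-comm n m) e))
  from : g n ≡ g m → SameBlock (kernelCode g) n m
  from e with <-cmp n m
  ... | tri< n<m _ _ = inj₂ (Equivalence.from (kernelCode-flat g n<m) e)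
  ... | tri≈ _ n≡m _ = inj₁ n≡m
  ... | tri> _ _ m<n = inj₂ (subst (λ k → kernelCode g k ≡ false) (flat-comm m n)
                             (Equivalence.from (kernelCode-flat g m<n) (sym e)))

kernelCode-isPartitionCode : ∀ g → IsPartitionCode (kernelCode g)
kernelCode-isPartitionCode g n m k n~m m~k =
  Equivalence.from (sameBlock-kernel⇔ g)
    (trans (Equivalence.to (sameBlock-kernel⇔ g) n~m) (Equivalence.to (sameBlock-kernel⇔ g) m~k))

-- The least j ≤ v satisfying P, or v if there is none.
leastUpTo : {P : ℕ → Set} → Decidable P → ℕ → ℕ
leastUpTo P? zero = zero
leastUpTo P? (suc v) with P? (leastUpTo P? v)
... | yes _ = leastUpTo P? v
... | no  _ = suc v

module _ {P : ℕ → Set} (P? : Decidable P) where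

  leastUpTo-≤ : ∀ v → leastUpTo P? v ≤ v
  leastUpTo-≤ zero = z≤n
  leastUpTo-≤ (suc v) with P? (leastUpTo P? v)
  ... | yes _ = m≤n⇒m≤1+n (leastUpTo-≤ v)
  ... | no  _ = ≤-refl

  leastUpTo-satisfies-or-≡ : ∀ v → P (leastUpTo P? v) ⊎ leastUpTo P? v ≡ v
  leastUpTo-satisfies-or-≡ zero = inj₂ refl
  leastUpTo-satisfies-or-≡ (suc v) with P? (leastUpTo P? v)
  ... | yes P-least = inj₁ P-least
  ... | no  _       = inj₂ refl

  leastUpTo-least : ∀ v {j} → j < leastUpTo P? v → ¬ P j
  leastUpTo-least (suc v) {j} j<least with P? (leastUpTo P? v)
  ... | yes _ = leastUpTo-least v j<least
  ... | no ¬P-least with <-cmp j (leastUpTo P? v) | leastUpTo-satisfies-or-≡ v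
  ...   | tri< j<l _ _  | _           = leastUpTo-least v j<l
  ...   | tri≈ _ refl _ | _           = ¬P-least
  ...   | tri> _ _ l<j  | inj₁ P-least = ⊥-elim (¬P-least P-least)
  ...   | tri> _ _ l<j  | inj₂ l≡v    = ⊥-elim (<⇒≱ (subst (_< j) l≡v l<j) (s≤s⁻¹ j<least))

blockMin : Real → ℕ → ℕ
blockMin c v = leastUpTo (λ j → SameBlock? c j v) v

blockMin-≤ : ∀ c v → blockMin c v ≤ v
blockMin-≤ c v = leastUpTo-≤ (λ j → SameBlock? c j v) v

blockMin-sameBlock : ∀ c v → SameBlock c (blockMin c v) v
blockMin-sameBlock c v with leastUpTo-satisfies-or-≡ (λ j → SameBlock? c j v) v
... | inj₁ same   = same
... | inj₂ min≡v = inj₁ min≡v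

blockMin-least : ∀ c v {j} → j < blockMin c v → ¬ SameBlock c j v
blockMin-least c v = leastUpTo-least (λ j → SameBlock? c j v) v

PositiveBlockMinimum : Real → ℕ → Set
PositiveBlockMinimum c t = t ≢ 0 × (∀ {j} → j < t → ¬ SameBlock c j t)

positiveBlockMinimum? : ∀ c t → Dec (PositiveBlockMinimum c t)
positiveBlockMinimum? c t = ¬? (t ≟ 0) ×-dec allUpTo? (λ j → ¬? (SameBlock? c j t)) t

-- 0 is the least element of its block in every partition; it is left out because the coding of
-- subsets of ω by partitions below reserves it.
positiveBlockMinima : Real → Real
positiveBlockMinima c t = does (positiveBlockMinimum? c t)

positiveBlockMinimum⇒blockMin≡ : ∀ {c t} → PositiveBlockMinimum c t → blockMin c t ≡ t
positiveBlockMinimum⇒blockMin≡ {c} {t} (_ , least) with m≤n⇒m<n∨m≡n (blockMin-≤ c t)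
... | inj₁ min<t = ⊥-elim (least min<t (blockMin-sameBlock c t))
... | inj₂ min≡t = min≡t

module _ (X : Real) (X-code : IsPartitionCode X) where

  blockMin-cong : ∀ {u v} → SameBlock X u v → blockMin X u ≡ blockMin X v
  blockMin-cong {u} {v} u~v with <-cmp (blockMin X u) (blockMin X v)
  ... | tri≈ _ u≡v _ = u≡v
  ... | tri< u<v _ _ = ⊥-elim (blockMin-least X v u<v (X-code _ _ _ (blockMin-sameBlock X u) u~v))
  ... | tri> _ _ v<u = ⊥-elim (blockMin-least X u v<u
                                 (X-code _ _ _ (blockMin-sameBlock X v) (SameBlock-sym {X} u~v)))

  sameBlock-of-blockMin≡ : ∀ {u v} → blockMin X u ≡ blockMin X v → SameBlock X u v
  sameBlock-of-blockMin≡ {u} {v} min≡min =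
    X-code _ _ _ (SameBlock-sym {X} (blockMin-sameBlock X u))
                 (subst (λ w → SameBlock X w v) (sym min≡min) (blockMin-sameBlock X v))

  blockMin-positiveBlockMinimum : ∀ v → blockMin X v ≢ 0 → PositiveBlockMinimum X (blockMin X v)
  blockMin-positiveBlockMinimum v nonzero =
    nonzero , λ j<min j~min → blockMin-least X v j<min (X-code _ _ _ j~min (blockMin-sameBlock X v))

  -- Of k + 2 numbers in distinct blocks one has block minimum > k: otherwise two of them would
  -- share a minimum ≤ k, by pigeonhole.
  positiveBlockMinima-infinite : InfManyBlocks X → Infinite (positiveBlockMinima X)
  positiveBlockMinima-infinite many k with many (suc (suc k))
  ... | e , inequivalent with Finₚ.any? (λ i → suc k ≤? blockMin X (e i))
  ...   | yes (i , k<min) = blockMin X (e i) , <⇒≤ k<min ,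
            dec-true (positiveBlockMinimum? X _)
              (blockMin-positiveBlockMinimum (e i) (λ min≡0 → <⇒≢ (≤-trans z<s k<min) (sym min≡0)))
  ...   | no  none = ⊥-elim (collision (Finₚ.pigeonhole ≤-refl squeeze))
    where
    min< : ∀ i → blockMin X (e i) < suc k
    min< i = ≰⇒> (λ k<min → none (i , k<min))
    squeeze : Fin (suc (suc k)) → Fin (suc k)
    squeeze i = fromℕ< (min< i)
    collision : ¬ (Σ _ λ i → Σ _ λ j → i Data.Fin.< j × squeeze i ≡ squeeze j)
    collision (i , j , i<j , i↦j) = inequivalent i j (Finₚ.<⇒≢ i<j) (sameBlock-of-blockMin≡
      (trans (sym (Finₚ.toℕ-fromℕ< (min< i))) (trans (cong toℕ i↦j) (Finₚ.toℕ-fromℕ< (min< j)))))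

module _ {y : Real} (y-infinite : Infinite y) where

  enumerate : ℕ → ℕ
  enumerate zero    = proj₁ (y-infinite zero)
  enumerate (suc i) = proj₁ (y-infinite (suc (enumerate i)))

  enumerate-∈ : ∀ i → y (enumerate i) ≡ true
  enumerate-∈ zero    = proj₂ (proj₂ (y-infinite zero))
  enumerate-∈ (suc i) = proj₂ (proj₂ (y-infinite (suc (enumerate i))))

  enumerate-strictlyIncreasing : ∀ {i j} → i < j → enumerate i < enumerate j
  enumerate-strictlyIncreasing {i} {suc j} i<1+j with m≤n⇒m<n∨m≡n (s≤s⁻¹ i<1+j)
  ... | inj₁ i<j  = <-trans (enumerate-strictlyIncreasing i<j) (proj₁ (proj₂ (y-infinite _)))
  ... | inj₂ refl = proj₁ (proj₂ (y-infinite _))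

  enumerate-injective : ∀ {i j} → enumerate i ≡ enumerate j → i ≡ j
  enumerate-injective {i} {j} eᵢ≡eⱼ with <-cmp i j
  ... | tri< i<j _ _ = ⊥-elim (<⇒≢ (enumerate-strictlyIncreasing i<j) eᵢ≡eⱼ)
  ... | tri≈ _ i≡j _ = i≡j
  ... | tri> _ _ j<i = ⊥-elim (<⇒≢ (enumerate-strictlyIncreasing j<i) (sym eᵢ≡eⱼ))

-- The largest j ≤ v with b j ≡ true, or 0 if there is none.
lastUpTo : (ℕ → Bool) → ℕ → ℕ
lastUpTo b zero    = zero
lastUpTo b (suc v) = if b (suc v) then suc v else lastUpTo b v

module _ (b : ℕ → Bool) where

  lastUpTo-≤ : ∀ v → lastUpTo b v ≤ v
  lastUpTo-≤ zero = z≤n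
  lastUpTo-≤ (suc v) with b (suc v)
  ... | true  = ≤-refl
  ... | false = m≤n⇒m≤1+n (lastUpTo-≤ v)

  lastUpTo-∈ : ∀ v → lastUpTo b v ≡ 0 ⊎ b (lastUpTo b v) ≡ true
  lastUpTo-∈ zero = inj₁ refl
  lastUpTo-∈ (suc v) with b (suc v) in bv
  ... | true  = inj₂ bv
  ... | false = lastUpTo-∈ v

  lastUpTo-fixed : ∀ v → v ≡ 0 ⊎ b v ≡ true → lastUpTo b v ≡ v
  lastUpTo-fixed zero    _            = refl
  lastUpTo-fixed (suc v) (inj₂ bv) rewrite bv = refl

module Coding {X y : Real} (X-code : IsPartitionCode X) (y⊆ : y ⊆ᵣ positiveBlockMinima X) where

  -- A number is labelled by the last element of y ∪ {0} not above the minimum of its X-block.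
  -- The fibres of the labelling form a coarsening of X whose positive block minima are y.
  label : ℕ → ℕ
  label v = lastUpTo y (blockMin X v)

  label-≤ : ∀ v → label v ≤ v
  label-≤ v = ≤-trans (lastUpTo-≤ y (blockMin X v)) (blockMin-≤ X v)

  label-∈ : ∀ v → label v ≡ 0 ⊎ y (label v) ≡ true
  label-∈ v = lastUpTo-∈ y (blockMin X v)

  label-fixed : ∀ a → a ≡ 0 ⊎ y a ≡ true → label a ≡ a
  label-fixed a a∈ = trans (cong (lastUpTo y) (blockMin-fixed a∈)) (lastUpTo-fixed y a a∈)
    where
    blockMin-fixed : a ≡ 0 ⊎ y a ≡ true → blockMin X a ≡ a
    blockMin-fixed (inj₁ refl) = n≤0⇒n≡0 (blockMin-≤ X 0)
    blockMin-fixed (inj₂ ya)   =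
      positiveBlockMinimum⇒blockMin≡ {X} (Equivalence.to (does≡true⇔ (positiveBlockMinimum? X a)) (y⊆ a ya))

  sameBlock-label⇔ : ∀ {n m} → SameBlock (kernelCode label) n m ⇔ label n ≡ label m
  sameBlock-label⇔ = sameBlock-kernel⇔ label

  labelKernel-⊑ : kernelCode label ⊑ X
  labelKernel-⊑ n m n~m =
    Equivalence.from sameBlock-label⇔ (cong (lastUpTo y) (blockMin-cong X X-code n~m))

  labelKernel-infManyBlocks : Infinite y → InfManyBlocks (kernelCode label)
  labelKernel-infManyBlocks y-infinite N = e , distinct
    where
    e : Fin N → ℕ
    e i = enumerate y-infinite (toℕ i)
    label-e : ∀ i → label (e i) ≡ e i
    label-e i = label-fixed (e i) (inj₂ (enumerate-∈ y-infinite (toℕ i)))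
    distinct : ∀ i j → i ≢ j → ¬ SameBlock (kernelCode label) (e i) (e j)
    distinct i j i≢j same = i≢j (Finₚ.toℕ-injective (enumerate-injective y-infinite
      (trans (sym (label-e i)) (trans (Equivalence.to sameBlock-label⇔ same) (label-e j)))))

  labelKernel-positiveBlockMinimum⇔ : ∀ t → PositiveBlockMinimum (kernelCode label) t ⇔ y t ≡ true
  labelKernel-positiveBlockMinimum⇔ t = mk⇔ to from
    where
    to : PositiveBlockMinimum (kernelCode label) t → y t ≡ true
    to (t≢0 , least) with m≤n⇒m<n∨m≡n (label-≤ t) | label-∈ t
    ... | inj₁ label<t | label∈ =
      ⊥-elim (least label<t (Equivalence.from sameBlock-label⇔ (label-fixed (label t) label∈)))
    ... | inj₂ label≡t | inj₁ label≡0 = ⊥-elim (t≢0 (trans (sym label≡t) label≡0))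
    ... | inj₂ label≡t | inj₂ y-label = subst (λ a → y a ≡ true) label≡t y-label
    from : y t ≡ true → PositiveBlockMinimum (kernelCode label) t
    from yt = proj₁ (Equivalence.to (does≡true⇔ (positiveBlockMinimum? X t)) (y⊆ t yt)) ,
      λ j<t same → <⇒≢ (≤-<-trans (label-≤ _) j<t)
                       (trans (Equivalence.to sameBlock-label⇔ same) (label-fixed t (inj₂ yt)))

coarsening-with-minima : ∀ {X y} → IsPartitionCode X → Infinite y → y ⊆ᵣ positiveBlockMinima X →
  Σ Real λ Y → InfPartition Y × Y ⊑ X × (∀ n → PositiveBlockMinimum Y n ⇔ y n ≡ true)
coarsening-with-minima {X} {y} X-code y-infinite y⊆ =
  kernelCode label ,
  (kernelCode-isPartitionCode label , labelKernel-infManyBlocks y-infinite) ,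
  labelKernel-⊑ ,
  labelKernel-positiveBlockMinimum⇔
  where open Coding {X} {y} X-code y⊆

rename : ∀ {k k'} → (Fin k → Fin k') → Term k → Term k'
rename r (var i)     = var (r i)
rename r zer         = zer
rename r (succ t)    = succ (rename r t)
rename r (plus t s)  = plus (rename r t) (rename r s)
rename r (times t s) = times (rename r t) (rename r s)

eval-rename : ∀ {k k'} (r : Fin k → Fin k') (ρ : Fin k' → ℕ) t →
  evalT ρ (rename r t) ≡ evalT (λ i → ρ (r i)) t
eval-rename r ρ (var i)     = refl
eval-rename r ρ zer         = refl
eval-rename r ρ (succ t)    = cong suc (eval-rename r ρ t)
eval-rename r ρ (plus t s)  = cong₂ _+_ (eval-rename r ρ t) (eval-rename r ρ s)
eval-rename r ρ (times t s) = cong₂ _*_ (eval-rename r ρ t) (eval-rename r ρ s)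

FlatWitness : Real → ℕ → ℕ → Set
FlatWitness c j t = Σ ℕ λ q → q + q + t ≡ t * t × c (q + j) ≡ true

flatWitness⇔ : ∀ {c j t} → j < t → FlatWitness c j t ⇔ c (flat j t) ≡ true
flatWitness⇔ {c} {j} {t} j<t = mk⇔
  (λ (q , twice , cq) → subst (λ k → c k ≡ true) (sym (flat-≡ twice j<t)) cq)
  (λ c-flat → triangle t , triangle-twice t , subst (λ k → c k ≡ true) (flat-< j<t) c-flat)

-- x ≠ 0 ∧ ∀ j < x. ∃ q. q + q + x = x * x ∧ q + j ∈ c, that is, c(♭{j,x}) for all j < x.
positiveBlockMinimumF : ∀ {k m} → Fin k → Fin m → Formula k m
positiveBlockMinimumF x c =
  conj (neg (eq (var x) zer))
       (allN (impl (lt (var fzero) (var (fsuc x)))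
         (exN (conj (eq (plus (plus (var fzero) (var fzero)) (var (fsuc (fsuc x))))
                        (times (var (fsuc (fsuc x))) (var (fsuc (fsuc x)))))
                    (mem (plus (var fzero) (var (fsuc fzero))) c)))))

arith-positiveBlockMinimumF : ∀ {k m} (x : Fin k) (c : Fin m) → Arith (positiveBlockMinimumF x c)
arith-positiveBlockMinimumF x c =
  conj (neg (eq _ _)) (allN (impl (lt _ _) (exN (conj (eq _ _) (mem _ _)))))

sat-positiveBlockMinimumF : ∀ {k m} (x : Fin k) (c : Fin m) ρ σ →
  Sat (positiveBlockMinimumF x c) ρ σ ⇔ PositiveBlockMinimum (σ c) (ρ x)
sat-positiveBlockMinimumF x c ρ σ = ⇔.refl ×-⇔ mk⇔
  (λ witnesses {j} j<t → Equivalence.to (differs j<t) (witnesses j j<t))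
  (λ least j j<t → Equivalence.from (differs j<t) (least j<t))
  where
  differs : ∀ {j} → j < ρ x → FlatWitness (σ c) j (ρ x) ⇔ (¬ SameBlock (σ c) j (ρ x))
  differs j<t = ⇔.trans (flatWitness⇔ {σ c} j<t) (differentBlocks⇔ {σ c} (<⇒≢ j<t))

-- How a real variable of the source formula is read off the reals of the target formula.
data Code (m : ℕ) : Set where
  plain    : Fin m → Code m
  minimaOf : Fin m → Code m

Decode : ∀ {m} → Code m → (Fin m → Real) → ℕ → Set
Decode (plain c)    σ n = σ c n ≡ true
Decode (minimaOf c) σ n = PositiveBlockMinimum (σ c) n

shift : ∀ {m} → Code m → Code (suc m)
shift (plain c)    = plain (fsuc c)
shift (minimaOf c) = minimaOf (fsuc c)

Decode-shift : ∀ {m} (a : Code m) X σ n → Decode (shift a) (extend X σ) n ≡ Decode a σ n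
Decode-shift (plain c)    X σ n = refl
Decode-shift (minimaOf c) X σ n = refl

memberF : ∀ {k m} → Term k → Code m → Formula k m
memberF t (plain c)    = mem t c
memberF t (minimaOf c) = exN (conj (eq (var fzero) (rename fsuc t)) (positiveBlockMinimumF fzero c))

sat-memberF : ∀ {k m} (t : Term k) (a : Code m) ρ σ → Sat (memberF t a) ρ σ ⇔ Decode a σ (evalT ρ t)
sat-memberF t (plain c)    ρ σ = ⇔.refl
sat-memberF t (minimaOf c) ρ σ = mk⇔
  (λ (n , n≡t , minimum) →
     subst (PositiveBlockMinimum (σ c)) (trans n≡t (t-shifted n)) (Equivalence.to (minimum⇔ n) minimum))
  (λ minimum → evalT ρ t , sym (t-shifted (evalT ρ t)) , Equivalence.from (minimum⇔ (evalT ρ t)) minimum)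
  where
  t-shifted : ∀ n → evalT (extend n ρ) (rename fsuc t) ≡ evalT ρ t
  t-shifted n = eval-rename fsuc (extend n ρ) t
  minimum⇔ : ∀ n → Sat (positiveBlockMinimumF fzero c) (extend n ρ) σ ⇔ PositiveBlockMinimum (σ c) n
  minimum⇔ n = sat-positiveBlockMinimumF fzero c (extend n ρ) σ

arith-memberF : ∀ {k m} (t : Term k) (a : Code m) → Arith (memberF t a)
arith-memberF t (plain c)    = mem t c
arith-memberF t (minimaOf c) = exN (conj (eq _ _) (arith-positiveBlockMinimumF fzero c))

liftCodes : ∀ {m m'} → (Fin m → Code m') → Fin (suc m) → Code (suc m')
liftCodes τ = extend (plain fzero) (λ i → shift (τ i))

translate : ∀ {k m m'} → (Fin m → Code m') → Formula k m → Formula k m'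
translate τ (eq t s)   = eq t s
translate τ (lt t s)   = lt t s
translate τ (mem t c)  = memberF t (τ c)
translate τ (neg φ)    = neg (translate τ φ)
translate τ (conj φ ψ) = conj (translate τ φ) (translate τ ψ)
translate τ (disj φ ψ) = disj (translate τ φ) (translate τ ψ)
translate τ (impl φ ψ) = impl (translate τ φ) (translate τ ψ)
translate τ (allN φ)   = allN (translate τ φ)
translate τ (exN φ)    = exN (translate τ φ)
translate τ (allR φ)   = allR (translate (liftCodes τ) φ)
translate τ (exR φ)    = exR (translate (liftCodes τ) φ)

Decodes : ∀ {m m'} → (Fin m → Code m') → (Fin m' → Real) → (Fin m → Real) → Set
Decodes τ σ' σ = ∀ i n → Decode (τ i) σ' n ⇔ σ i n ≡ true

liftCodes-decodes : ∀ {m m'} {τ : Fin m → Code m'} {σ' σ} → Decodes τ σ' σ →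
  ∀ X → Decodes (liftCodes τ) (extend X σ') (extend X σ)
liftCodes-decodes         decodes X fzero    n = ⇔.refl
liftCodes-decodes {τ = τ} {σ'} decodes X (fsuc i) n =
  subst (_⇔ _) (sym (Decode-shift (τ i) X σ' n)) (decodes i n)

Π-cong-⇔ : {A : Set} {B C : A → Set} → (∀ a → B a ⇔ C a) → ((a : A) → B a) ⇔ ((a : A) → C a)
Π-cong-⇔ B⇔C = mk⇔ (λ f a → Equivalence.to (B⇔C a) (f a)) (λ g a → Equivalence.from (B⇔C a) (g a))

Σ-cong-⇔ : {A : Set} {B C : A → Set} → (∀ a → B a ⇔ C a) → Σ A B ⇔ Σ A C
Σ-cong-⇔ B⇔C = mk⇔ (λ (a , b) → a , Equivalence.to (B⇔C a) b) (λ (a , c) → a , Equivalence.from (B⇔C a) c)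

sat-translate : ∀ {k m m'} (φ : Formula k m) {τ : Fin m → Code m'} {σ' σ} → Decodes τ σ' σ →
  ∀ ρ → Sat (translate τ φ) ρ σ' ⇔ Sat φ ρ σ
sat-translate (eq t s)   d ρ = ⇔.refl
sat-translate (lt t s)   d ρ = ⇔.refl
sat-translate (mem t c) {τ} {σ'} d ρ = ⇔.trans (sat-memberF t (τ c) ρ σ') (d c (evalT ρ t))
sat-translate (neg φ)    d ρ = ¬-cong-⇔ (sat-translate φ d ρ)
sat-translate (conj φ ψ) d ρ = sat-translate φ d ρ ×-⇔ sat-translate ψ d ρ
sat-translate (disj φ ψ) d ρ = sat-translate φ d ρ ⊎-⇔ sat-translate ψ d ρ
sat-translate (impl φ ψ) d ρ = →-cong-⇔ (sat-translate φ d ρ) (sat-translate ψ d ρ)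
sat-translate (allN φ)   d ρ = Π-cong-⇔ λ a → sat-translate φ d (extend a ρ)
sat-translate (exN φ)    d ρ = Σ-cong-⇔ λ a → sat-translate φ d (extend a ρ)
sat-translate (allR φ)   d ρ = Π-cong-⇔ λ X → sat-translate φ (liftCodes-decodes d X) ρ
sat-translate (exR φ)    d ρ = Σ-cong-⇔ λ X → sat-translate φ (liftCodes-decodes d X) ρ

arith-translate : ∀ {k m m'} {φ : Formula k m} (τ : Fin m → Code m') → Arith φ → Arith (translate τ φ)
arith-translate τ (eq t s)   = eq t s
arith-translate τ (lt t s)   = lt t s
arith-translate τ (mem t c)  = arith-memberF t (τ c)
arith-translate τ (neg a)    = neg (arith-translate τ a)
arith-translate τ (conj a b) = conj (arith-translate τ a) (arith-translate τ b)
arith-translate τ (disj a b) = disj (arith-translate τ a) (arith-translate τ b)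
arith-translate τ (impl a b) = impl (arith-translate τ a) (arith-translate τ b)
arith-translate τ (allN a)   = allN (arith-translate τ a)
arith-translate τ (exN a)    = exN (arith-translate τ a)

mutual
  Σ¹-translate : ∀ {k n m m'} {φ : Formula k m} (τ : Fin m → Code m') → IsΣ¹ n φ → IsΣ¹ n (translate τ φ)
  Σ¹-translate τ (arith a) = arith (arith-translate τ a)
  Σ¹-translate τ (ex φ∈Π)  = ex (Π¹-translate (liftCodes τ) φ∈Π)

  Π¹-translate : ∀ {k n m m'} {φ : Formula k m} (τ : Fin m → Code m') → IsΠ¹ n φ → IsΠ¹ n (translate τ φ)
  Π¹-translate τ (arith a) = arith (arith-translate τ a)
  Π¹-translate τ (all φ∈Σ) = all (Σ¹-translate (liftCodes τ) φ∈Σ)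

ramsey-from-dualRamsey : {A C : Real → Set} →
  (∀ X → InfPartition X → Σ Real λ x → Infinite x ×
     (∀ y → Infinite y → y ⊆ᵣ x → Σ Real λ Y → InfPartition Y × Y ⊑ X × (A Y ⇔ C y))) →
  DualRamseyProperty A → RamseyProperty C
ramsey-from-dualRamsey {A} {C} reduce (X , X-partition , homogeneous) with reduce X X-partition
... | x , x-infinite , coded = x , x-infinite , Sum.map inside outside homogeneous
  where
  inside : (∀ Y → InfPartition Y → Y ⊑ X → A Y) → ∀ y → Infinite y → y ⊆ᵣ x → C y
  inside all-in y y-infinite y⊆x with coded y y-infinite y⊆x
  ... | Y , Y-partition , Y⊑X , A⇔C = Equivalence.to A⇔C (all-in Y Y-partition Y⊑X)
  outside : (∀ Y → InfPartition Y → Y ⊑ X → ¬ A Y) → ∀ y → Infinite y → y ⊆ᵣ x → ¬ C y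
  outside all-out y y-infinite y⊆x with coded y y-infinite y⊆x
  ... | Y , Y-partition , Y⊑X , A⇔C = all-out Y Y-partition Y⊑X ∘ Equivalence.from A⇔C

-- The parameter x of a formula is replaced by the positive block minima of a new parameter Y.
minimaOfZero : ∀ {m} → Fin (suc m) → Code (suc m)
minimaOfZero = extend (minimaOf fzero) (λ i → plain (fsuc i))

defSet-translate : ∀ {m} (φ : Formula 0 (suc m)) (p : Fin m → Real) {Y y} →
  (∀ n → PositiveBlockMinimum Y n ⇔ y n ≡ true) →
  DefSet (translate minimaOfZero φ) p Y ⇔ DefSet φ p y
defSet-translate φ p Y⇔y = sat-translate φ decodes noNum
  where
  decodes : Decodes minimaOfZero (extend _ p) (extend _ p)
  decodes fzero    = Y⇔y
  decodes (fsuc i) n = ⇔.refl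

lemma7p2 : ExcludedMiddle 0ℓ → (n : ℕ) → 1 ≤ n →
    ((m : ℕ) (φ : Formula 0 (suc m)) → IsΣ¹ n φ → (p : Fin m → Real) →
      DualRamseyProperty (DefSet φ p)) →
    ((m : ℕ) (φ : Formula 0 (suc m)) → IsΣ¹ n φ → (p : Fin m → Real) →
      RamseyProperty (DefSet φ p))
lemma7p2 _ n _ dualRamsey m φ φ∈Σ p =
  ramsey-from-dualRamsey reduce
    (dualRamsey m (translate minimaOfZero φ) (Σ¹-translate minimaOfZero φ∈Σ) p)
  where
  reduce : ∀ X → InfPartition X → Σ Real λ x → Infinite x ×
    (∀ y → Infinite y → y ⊆ᵣ x → Σ Real λ Y → InfPartition Y × Y ⊑ X ×
      (DefSet (translate minimaOfZero φ) p Y ⇔ DefSet φ p y))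
  reduce X (X-code , X-many) =
    positiveBlockMinima X , positiveBlockMinima-infinite X X-code X-many ,
    λ y y-infinite y⊆ →
      let Y , Y-partition , Y⊑X , Y⇔y = coarsening-with-minima {X} {y} X-code y-infinite y⊆
      in  Y , Y-partition , Y⊑X , defSet-translate φ p Y⇔y
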